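{- Let $t\le d$ be positive integers, let $C$ be a $d$-pseudomanifold and let $v$ be a new point. Then $C$ is $t$-LC if and only if the cone $v\ast C$ (a $(d+1)$-pseudomanifold) is $t$-LC.
   Context: A simplicial regular CW-complex is a finite regular CW-complex in which for every proper face $F$ the interval $[\emptyset,F]$ of the face poset is Boolean. A $d$-pseudomanifold is a finite simplicial regular CW-complex, pure $d$-dimensional, in which every $(d-1)$-cell lies in at most two $d$-cells; boundary $(d-1)$-faces lie in exactly one $d$-cell. A tree of $d$-simplices is a simplicial complex triangulating the $d$-ball whose dual graph is a tree. For an $n$-pseudomanifold and $t\in\{1,\dots,n\}$, it is $t$-LC if it is obtainable from a tree of $n$-simplices by recursively identifying two boundary $(n-1)$-faces whose intersection has dimension at least $n-1-t$ (glued faces become interior). -}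

module Defs where

open import Data.Nat using (ℕ; zero; suc; _≤_; _∸_)
open import Data.Fin using (Fin; toℕ; inject₁) renaming (suc to fsuc)
open import Data.Fin.Subset using (Subset; _⊆_; _∉_; ∣_∣)
open import Data.Fin.Permutation using (Permutation′; _⟨$⟩ʳ_; _⟨$⟩ˡ_)
open import Data.Vec using (tabulate; lookup)
open import Data.Bool using (Bool; true; false)
open import Data.List using (List; []; _∷_; _++_; concatMap)
import Data.List as List
open import Data.List.Membership.Propositional using (_∈_)
open import Data.List.Relation.Unary.Unique.Propositional using (Unique)
open import Data.Product using (Σ; ∃; ∃-syntax; _×_; _,_; proj₁; proj₂)
open import Data.Sum using (_⊎_)
open import Data.Unit using (⊤)
open import Data.Empty using (⊥)
open import Relation.Binary.PropositionalEquality using (_≡_; _≢_)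
open import Relation.Binary.Structures using (IsPartialOrder)
open import Relation.Binary.Construct.Closure.Equivalence using (EqClosure)
open import Function.Bundles using (_⇔_)

-- The interval [⊥, x] of a relation _≤_ on Fin m is isomorphic (as a
-- poset) to the Boolean lattice of subsets of Fin k.  Then x has
-- dimension k - 1.
BooleanInterval : {m : ℕ} → (Fin m → Fin m → Set) → Fin m → ℕ → Set
BooleanInterval {m} _≤ₚ_ x k =
  Σ (Subset k → Fin m) λ f →
      (∀ S → f S ≤ₚ x)
    × (∀ y → y ≤ₚ x → ∃ λ S → f S ≡ y)
    × (∀ S T → (S ⊆ T) ⇔ (f S ≤ₚ f T))

record SimplicialRegularCW : Set₁ where
  field
    size           : ℕ
    _≤ₚ_           : Fin size → Fin size → Set
    isPartialOrder : IsPartialOrder _≡_ _≤ₚ_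
    empty          : Fin size
    empty-least    : ∀ x → empty ≤ₚ x
    boolean        : ∀ x → ∃[ k ] BooleanInterval _≤ₚ_ x k

IsPseudomanifold : SimplicialRegularCW → ℕ → Set
IsPseudomanifold C d =
    (∀ x k → BooleanInterval _≤ₚ_ x k → k ≤ suc d)
  × (∀ x → ∃ λ y → x ≤ₚ y × BooleanInterval _≤ₚ_ y (suc d))
  × (∀ r y₁ y₂ y₃ → BooleanInterval _≤ₚ_ r d
       → BooleanInterval _≤ₚ_ y₁ (suc d) → BooleanInterval _≤ₚ_ y₂ (suc d)
       → BooleanInterval _≤ₚ_ y₃ (suc d)
       → r ≤ₚ y₁ → r ≤ₚ y₂ → r ≤ₚ y₃
       → (y₁ ≡ y₂) ⊎ (y₁ ≡ y₃) ⊎ (y₂ ≡ y₃))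
  where open SimplicialRegularCW C

record RawPoset : Set₁ where
  field
    Carrier : Set
    _≼_     : Carrier → Carrier → Set

raw : SimplicialRegularCW → RawPoset
raw C = record { Carrier = Fin size ; _≼_ = _≤ₚ_ }
  where open SimplicialRegularCW C

_≤𝔹_ : Bool → Bool → Set
false ≤𝔹 _    = ⊤
true  ≤𝔹 false = ⊥
true  ≤𝔹 true  = ⊤

-- Face poset of the cone v ∗ C: cells are (σ , false) = σ and
-- (σ , true) = v ∗ σ; the new vertex v is (empty , true).
cone : RawPoset → RawPoset
cone P = record
  { Carrier = Carrier × Bool
  ; _≼_     = λ x y → (proj₁ x ≼ proj₁ y) × (proj₂ x ≤𝔹 proj₂ y) }
  where open RawPoset P

-- Gluing d-simplices.  N simplices of dimension n, each with vertex set
-- Fin (suc n); a cell of the disjoint union is (simplex , vertex subset).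

Cell : ℕ → ℕ → Set
Cell N n = Fin N × Subset (suc n)

-- Identify the facet "all vertices but a₁" of simplex s₁ with the facet
-- "all vertices but a₂" of simplex s₂ via the vertex bijection π
-- (a permutation of Fin (suc n) sending a₁ to a₂).
record Gluing (N n : ℕ) : Set where
  field
    s₁ s₂ : Fin N
    a₁ a₂ : Fin (suc n)
    π     : Permutation′ (suc n)
    π-a   : π ⟨$⟩ʳ a₁ ≡ a₂
open Gluing public

image : ∀ {n} → Permutation′ n → Subset n → Subset n
image π S = tabulate (λ y → lookup S (π ⟨$⟩ˡ y))

data GlueStep {N n : ℕ} (gs : List (Gluing N n)) : Cell N n → Cell N n → Set where
  glue : ∀ {g} → g ∈ gs → ∀ S → a₁ g ∉ S →
         GlueStep gs (s₁ g , S) (s₂ g , image (π g) S)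

_~[_]_ : ∀ {N n} → Cell N n → List (Gluing N n) → Cell N n → Set
x ~[ gs ] y = EqClosure (GlueStep gs) x y

_≼[_]_ : ∀ {N n} → Cell N n → List (Gluing N n) → Cell N n → Set
x ≼[ gs ] y = ∃ λ x′ → ∃ λ y′ → x ~[ gs ] x′ × y ~[ gs ] y′
                × proj₁ x′ ≡ proj₁ y′ × proj₂ x′ ⊆ proj₂ y′

usedFacets : ∀ {N n} → List (Gluing N n) → List (Fin N × Fin (suc n))
usedFacets = concatMap (λ g → (s₁ g , a₁ g) ∷ (s₂ g , a₂ g) ∷ [])

-- In the complex obtained by the gluings gs, the two facets of g intersect
-- in dimension ≥ n - 1 - t, i.e. share a face with ≥ n - t vertices.
Admissible : ℕ → ∀ {N n} → List (Gluing N n) → Gluing N n → Set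
Admissible t {N} {n} gs g =
  ∃ λ S → ∃ λ T → a₁ g ∉ S × a₂ g ∉ T × (n ∸ t ≤ ∣ S ∣)
                × ((s₁ g , S) ~[ gs ] (s₂ g , T))

LCSteps : ℕ → ∀ {N n} → List (Gluing N n) → List (Gluing N n) → Set
LCSteps t gs []       = ⊤
LCSteps t gs (e ∷ es) = Admissible t gs e × LCSteps t (gs ++ e ∷ []) es

-- A tree of suc m n-simplices: simplex (k+1) is glued along a facet to
-- an earlier simplex (indices ≤ k); this encodes an arbitrary tree dual graph.
IsTreeGluing : ∀ {m n} → (Fin m → Gluing (suc m) n) → Set
IsTreeGluing {m} tg = ∀ k → s₁ (tg k) ≡ fsuc k × toℕ (s₂ (tg k)) ≤ toℕ k

IsoToQuotient : ∀ {N n} → RawPoset → List (Gluing N n) → Set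
IsoToQuotient {N} {n} P gs =
  Σ (Cell N n → Carrier) λ f →
      (∀ c → ∃ λ x → f x ≡ c)
    × (∀ x y → (f x ≡ f y) ⇔ (x ~[ gs ] y))
    × (∀ x y → (f x ≼ f y) ⇔ (x ≼[ gs ] y))
  where open RawPoset P

IsLC : ℕ → ℕ → RawPoset → Set
IsLC t n P =
  ∃ λ m → Σ (Fin m → Gluing (suc m) n) λ tg → Σ (List (Gluing (suc m) n)) λ es →
      IsTreeGluing tg
    × Unique (usedFacets (List.tabulate tg ++ es))
    × LCSteps t (List.tabulate tg) es
    × IsoToQuotient P (List.tabulate tg ++ es)

-- A presentation of C (a tree of d-simplices followed by gluings) yields one of
-- v ∗ C: add a new vertex 0, the apex, to every simplex and extend every vertex
-- bijection by 0 ↦ 0.  A shared face with ≥ d − t vertices of two glued facets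
-- then becomes one with ≥ d + 1 − t vertices, so t-LC steps stay t-LC steps.
-- Conversely, in any presentation of v ∗ C each simplex has a vertex sent to v;
-- no gluing deletes it, and every gluing maps it to the apex of the other
-- simplex.  Deleting these apexes yields a presentation of C with the same
-- gluing sequence, and the intersection conditions correspond as before.

module Submission where

open import Defs
open import Data.Nat using (ℕ; zero; suc; _≤_; _∸_; z≤n; s≤s)
open import Data.Nat.Properties using (≤-refl; ≤-trans; n≤1+n; 0∸n≡0; 1+n≢n)
open import Data.Bool using (Bool; true; false)
open import Data.Unit using (tt)
open import Data.Product using (∃; _×_; _,_; proj₁; proj₂)
open import Data.Sum using (_⊎_; inj₁; inj₂)
open import Data.Fin using (Fin; punchIn; punchOut) renaming (zero to fzero; suc to fsuc)
open import Data.Fin.Properties using (punchIn-injective; punchIn-punchOut) renaming (_≟_ to _≟ᶠ_)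
open import Data.Fin.Subset using (Subset; _⊆_; _∈_; _∉_; ∣_∣; ⁅_⁆; ⊤; ⊥)
open import Data.Fin.Subset.Properties
  using (∈⊤; ⊆⊤; ∉⊥; ⊆-antisym; Empty-unique; nonempty?; x∈⁅y⁆⇒x≡y; ∣⊥∣≡0; ∣⁅x⁆∣≡1)
open import Data.Fin.Permutation
  using (Permutation′; _⟨$⟩ʳ_; _⟨$⟩ˡ_; flip; remove; lift₀; inverseˡ; inverseʳ; punchIn-permute)
open import Data.Vec using (Vec; []; _∷_; lookup; tabulate; insertAt; removeAt)
open import Data.Vec.Properties
  using ( tabulate∘lookup; tabulate-cong; lookup∘tabulate; insertAt-lookup; insertAt-punchIn
        ; removeAt-insertAt; insertAt-removeAt; []=⇒lookup; lookup⇒[]=)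
open import Data.List using (List; []; _∷_; _++_)
import Data.List as List
open import Data.List.Properties using (map-id)
open import Data.List.Membership.Propositional using () renaming (_∈_ to _∈ₗ_)
open import Data.List.Membership.Propositional.Properties using (∈-++⁺ˡ; ∈-++⁺ʳ; ∈-tabulate⁺)
open import Data.List.Relation.Unary.Any using (here; there)
open import Data.List.Relation.Unary.All as All using (All; []; _∷_)
open import Data.List.Relation.Unary.AllPairs using (_∷_)
open import Data.List.Relation.Unary.Unique.Propositional using (Unique)
import Data.List.Relation.Unary.Unique.Propositional.Properties as Uniqueₚ
open import Data.List.Relation.Binary.Pointwise as Pointwise using (Pointwise; []; _∷_)
open import Function using (_∘_; id)
open import Function.Bundles using (_⇔_; mk⇔; Equivalence)
open Equivalence using (to; from)
open import Relation.Nullary using (yes; no; contradiction)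
open import Relation.Binary.Structures using (IsPartialOrder)
open import Relation.Binary.PropositionalEquality
  using (_≡_; _≢_; refl; sym; trans; cong; cong₂; subst; subst₂; isEquivalence; module ≡-Reasoning)
open import Relation.Binary.Construct.Closure.ReflexiveTransitive using (ε; _◅_; _◅◅_)
open import Relation.Binary.Construct.Closure.Symmetric using (fwd; bwd)
import Relation.Binary.Construct.Closure.Equivalence as EqClosure

open ≡-Reasoning

-- Vertex subsets

lookup-extensionality : ∀ {a} {A : Set a} {n} {V W : Vec A n} →
                        (∀ i → lookup V i ≡ lookup W i) → V ≡ W
lookup-extensionality {V = V} {W} V≗W =
  trans (sym (tabulate∘lookup V)) (trans (tabulate-cong V≗W) (tabulate∘lookup W))

lookup-removeAt : ∀ {a} {A : Set a} {n} (V : Vec A (suc n)) i j →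
                  lookup (removeAt V i) j ≡ lookup V (punchIn i j)
lookup-removeAt V i j = begin
  lookup (removeAt V i) j
    ≡⟨ sym (insertAt-punchIn (removeAt V i) i (lookup V i) j) ⟩
  lookup (insertAt (removeAt V i) i (lookup V i)) (punchIn i j)
    ≡⟨ cong (λ W → lookup W (punchIn i j)) (insertAt-removeAt V i) ⟩
  lookup V (punchIn i j) ∎

≡⊎≡punchIn : ∀ {n} (i j : Fin (suc n)) → j ≡ i ⊎ ∃ λ k → j ≡ punchIn i k
≡⊎≡punchIn i j with j ≟ᶠ i
... | yes j≡i = inj₁ j≡i
... | no  j≢i = inj₂ (punchOut (j≢i ∘ sym) , sym (punchIn-punchOut _))

⊆-fromLookup : ∀ {n} {S T : Subset n} →
               (∀ i → lookup S i ≡ true → lookup T i ≡ true) → S ⊆ T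
⊆-fromLookup S⊆T {i} i∈S = lookup⇒[]= i _ (S⊆T i ([]=⇒lookup i∈S))

⊆-lookup : ∀ {n} {S T : Subset n} → S ⊆ T → ∀ i → lookup S i ≡ true → lookup T i ≡ true
⊆-lookup S⊆T i S[i] = []=⇒lookup (S⊆T (lookup⇒[]= i _ S[i]))

≤𝔹-true : ∀ {b c} → b ≤𝔹 c → b ≡ true → c ≡ true
≤𝔹-true {true}  {true}  _  _  = refl
≤𝔹-true {true}  {false} () _
≤𝔹-true {false} _       ()

true⇒≤𝔹 : ∀ {b c} → (b ≡ true → c ≡ true) → b ≤𝔹 c
true⇒≤𝔹 {false}         _ = tt
true⇒≤𝔹 {true}  {true}  _ = tt
true⇒≤𝔹 {true}  {false} h with () ← h refl

false≤𝔹 : ∀ {b c} → b ≡ false → b ≤𝔹 c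
false≤𝔹 refl = tt

insertAt-⊆⁺ : ∀ {n} {S T : Subset n} {i b c} →
              b ≤𝔹 c → S ⊆ T → insertAt S i b ⊆ insertAt T i c
insertAt-⊆⁺ {S = S} {T} {i} {b} {c} b≤c S⊆T = ⊆-fromLookup at
  where
  at : ∀ j → lookup (insertAt S i b) j ≡ true → lookup (insertAt T i c) j ≡ true
  at j with ≡⊎≡punchIn i j
  ... | inj₁ refl = λ e →
    trans (insertAt-lookup T i c) (≤𝔹-true b≤c (trans (sym (insertAt-lookup S i b)) e))
  ... | inj₂ (k , refl) = λ e →
    trans (insertAt-punchIn T i c k) (⊆-lookup S⊆T k (trans (sym (insertAt-punchIn S i b k)) e))

insertAt-⊆⁻ : ∀ {n} {S T : Subset n} {i b c} →
              insertAt S i b ⊆ insertAt T i c → b ≤𝔹 c × S ⊆ T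
insertAt-⊆⁻ {S = S} {T} {i} {b} {c} ⊆′ =
    true⇒≤𝔹 (λ e → trans (sym (insertAt-lookup T i c))
                     (⊆-lookup ⊆′ i (trans (insertAt-lookup S i b) e)))
  , ⊆-fromLookup (λ j e → trans (sym (insertAt-punchIn T i c j))
                            (⊆-lookup ⊆′ (punchIn i j) (trans (insertAt-punchIn S i b j) e)))

removeAt-⊆ : ∀ {n} {V W : Subset (suc n)} i →
             V ⊆ W → lookup V i ≤𝔹 lookup W i × removeAt V i ⊆ removeAt W i
removeAt-⊆ {V = V} {W} i V⊆W =
  insertAt-⊆⁻ (subst₂ _⊆_ (sym (insertAt-removeAt V i)) (sym (insertAt-removeAt W i)) V⊆W)

⊆-insertAt-false : ∀ {n} {S : Subset n} {T i} →
                   T ⊆ insertAt S i true → lookup T i ≡ false → T ⊆ insertAt S i false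
⊆-insertAt-false {S = S} {T} {i} T⊆ T[i]≡false =
  subst (_⊆ insertAt S i false) T≡
    (insertAt-⊆⁺ tt (proj₂ (insertAt-⊆⁻ (subst (_⊆ insertAt S i true) (sym T≡) T⊆))))
  where
  T≡ : insertAt (removeAt T i) i false ≡ T
  T≡ = trans (cong (insertAt (removeAt T i) i) (sym T[i]≡false)) (insertAt-removeAt T i)

insertAt-⊤ : ∀ {n} (i : Fin (suc n)) → insertAt ⊤ i true ≡ ⊤
insertAt-⊤ i = ⊆-antisym ⊆⊤ (⊆-fromLookup at)
  where
  at : ∀ j → lookup ⊤ j ≡ true → lookup (insertAt ⊤ i true) j ≡ true
  at j _ with ≡⊎≡punchIn i j
  ... | inj₁ refl       = insertAt-lookup ⊤ i true
  ... | inj₂ (k , refl) = trans (insertAt-punchIn ⊤ i true k) ([]=⇒lookup (∈⊤ {x = k}))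

insertAt-⊤-false : ∀ {n} {i j : Fin (suc n)} → lookup (insertAt ⊤ i false) j ≡ false → j ≡ i
insertAt-⊤-false {i = i} {j} j∉ with ≡⊎≡punchIn i j
... | inj₁ j≡i       = j≡i
... | inj₂ (k , refl) =
  contradiction (trans (sym ([]=⇒lookup (∈⊤ {x = k})))
                       (trans (sym (insertAt-punchIn ⊤ i false k)) j∉)) λ ()

⊆⊥⇒≡⊥ : ∀ {n} {T : Subset n} → T ⊆ ⊥ → T ≡ ⊥
⊆⊥⇒≡⊥ T⊆⊥ = Empty-unique λ (_ , i∈T) → ∉⊥ (T⊆⊥ i∈T)

∈⇒⁅⁆⊆ : ∀ {n} {i : Fin n} {S} → i ∈ S → ⁅ i ⁆ ⊆ S
∈⇒⁅⁆⊆ {i = i} {S} i∈S j∈⁅i⁆ = subst (_∈ S) (sym (x∈⁅y⁆⇒x≡y i j∈⁅i⁆)) i∈S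

∉-insertAt : ∀ {n} {S : Subset n} {i b a} → a ∉ S → punchIn i a ∉ insertAt S i b
∉-insertAt {S = S} {i} {b} {a} a∉S a∈ =
  a∉S (lookup⇒[]= a S (trans (sym (insertAt-punchIn S i b a)) ([]=⇒lookup a∈)))

∉-removeAt : ∀ {n} {V : Subset (suc n)} {i a} → punchIn i a ∉ V → a ∉ removeAt V i
∉-removeAt {V = V} {i} {a} a∉V a∈ =
  a∉V (lookup⇒[]= _ V (trans (sym (lookup-removeAt V i a)) ([]=⇒lookup a∈)))

∣insertAt∣ : ∀ {n} (S : Subset n) i b → ∣ insertAt S i b ∣ ≡ ∣ b ∷ S ∣
∣insertAt∣ S           fzero    b     = refl
∣insertAt∣ (true ∷ S)  (fsuc i) true  = cong suc (∣insertAt∣ S i true)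
∣insertAt∣ (true ∷ S)  (fsuc i) false = cong suc (∣insertAt∣ S i false)
∣insertAt∣ (false ∷ S) (fsuc i) b     = ∣insertAt∣ S i b

∣V∣≤1+∣removeAt∣ : ∀ {n} (V : Subset (suc n)) i → ∣ V ∣ ≤ suc ∣ removeAt V i ∣
∣V∣≤1+∣removeAt∣ V i =
  subst (_≤ suc ∣ removeAt V i ∣)
    (trans (sym (∣insertAt∣ (removeAt V i) i (lookup V i))) (cong ∣_∣ (insertAt-removeAt V i)))
    (∣∷∣≤ (lookup V i))
  where
  ∣∷∣≤ : ∀ b → ∣ b ∷ removeAt V i ∣ ≤ suc ∣ removeAt V i ∣
  ∣∷∣≤ true  = ≤-refl
  ∣∷∣≤ false = n≤1+n _

m∸n≤k⇒1+m∸n≤1+k : ∀ m n k → m ∸ n ≤ k → suc m ∸ n ≤ suc k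
m∸n≤k⇒1+m∸n≤1+k m       zero    k h = s≤s h
m∸n≤k⇒1+m∸n≤1+k zero    (suc n) k h = subst (_≤ suc k) (sym (0∸n≡0 n)) z≤n
m∸n≤k⇒1+m∸n≤1+k (suc m) (suc n) k h = m∸n≤k⇒1+m∸n≤1+k m n k h

1+m∸n≤1+k⇒m∸n≤k : ∀ m n k → suc m ∸ n ≤ suc k → m ∸ n ≤ k
1+m∸n≤1+k⇒m∸n≤k m       zero    k (s≤s h) = h
1+m∸n≤1+k⇒m∸n≤k zero    (suc n) k h       = z≤n
1+m∸n≤1+k⇒m∸n≤k (suc m) (suc n) k h       = 1+m∸n≤1+k⇒m∸n≤k m n k h

lookup-image : ∀ {n} (π : Permutation′ n) S y → lookup (image π S) y ≡ lookup S (π ⟨$⟩ˡ y)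
lookup-image π S = lookup∘tabulate (λ y → lookup S (π ⟨$⟩ˡ y))

image-insertAt : ∀ {n} (π : Permutation′ (suc n)) (S : Subset n) i b →
                 image π (insertAt S i b) ≡ insertAt (image (remove i π) S) (π ⟨$⟩ʳ i) b
image-insertAt π S i b = lookup-extensionality at
  where
  at : ∀ y → lookup (image π (insertAt S i b)) y
             ≡ lookup (insertAt (image (remove i π) S) (π ⟨$⟩ʳ i) b) y
  at y with ≡⊎≡punchIn (π ⟨$⟩ʳ i) y
  ... | inj₁ refl = begin
    lookup (image π (insertAt S i b)) (π ⟨$⟩ʳ i) ≡⟨ lookup-image π (insertAt S i b) _ ⟩
    lookup (insertAt S i b) (π ⟨$⟩ˡ (π ⟨$⟩ʳ i)) ≡⟨ cong (lookup (insertAt S i b)) (inverseˡ π) ⟩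
    lookup (insertAt S i b) i                   ≡⟨ insertAt-lookup S i b ⟩
    b                                           ≡⟨ sym (insertAt-lookup _ (π ⟨$⟩ʳ i) b) ⟩
    lookup (insertAt (image (remove i π) S) (π ⟨$⟩ʳ i) b) (π ⟨$⟩ʳ i) ∎
  ... | inj₂ (k , refl) = begin
    lookup (image π (insertAt S i b)) (punchIn (π ⟨$⟩ʳ i) k)
      ≡⟨ lookup-image π (insertAt S i b) _ ⟩
    lookup (insertAt S i b) (π ⟨$⟩ˡ punchIn (π ⟨$⟩ʳ i) k)
      ≡⟨ cong (lookup (insertAt S i b)) (sym (punchIn-punchOut _)) ⟩
    lookup (insertAt S i b) (punchIn i (remove i π ⟨$⟩ˡ k))
      ≡⟨ insertAt-punchIn S i b _ ⟩
    lookup S (remove i π ⟨$⟩ˡ k)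
      ≡⟨ sym (lookup-image (remove i π) S k) ⟩
    lookup (image (remove i π) S) k
      ≡⟨ sym (insertAt-punchIn _ (π ⟨$⟩ʳ i) b k) ⟩
    lookup (insertAt (image (remove i π) S) (π ⟨$⟩ʳ i) b) (punchIn (π ⟨$⟩ʳ i) k) ∎

∣image∣ : ∀ {n} (π : Permutation′ n) (S : Subset n) → ∣ image π S ∣ ≡ ∣ S ∣
∣image∣ {zero}  π []      = refl
∣image∣ {suc n} π (b ∷ S) = begin
  ∣ image π (b ∷ S) ∣                                ≡⟨ cong ∣_∣ (image-insertAt π S fzero b) ⟩
  ∣ insertAt (image π′ S) (π ⟨$⟩ʳ fzero) b ∣        ≡⟨ ∣insertAt∣ (image π′ S) (π ⟨$⟩ʳ fzero) b ⟩
  ∣ b ∷ image π′ S ∣                                 ≡⟨ ∣∷∣ b ⟩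
  ∣ b ∷ S ∣                                          ∎
  where
  π′ = remove fzero π
  ∣∷∣ : ∀ b → ∣ b ∷ image π′ S ∣ ≡ ∣ b ∷ S ∣
  ∣∷∣ true  = cong suc (∣image∣ π′ S)
  ∣∷∣ false = ∣image∣ π′ S

image-⊤ : ∀ {n} (π : Permutation′ n) → image π ⊤ ≡ ⊤
image-⊤ π = ⊆-antisym ⊆⊤ (⊆-fromLookup λ y _ →
  trans (lookup-image π ⊤ y) ([]=⇒lookup (∈⊤ {x = π ⟨$⟩ˡ y})))

image-⊆ : ∀ {n} (π : Permutation′ n) {S T : Subset n} → S ⊆ T → image π S ⊆ image π T
image-⊆ π {S} {T} S⊆T = ⊆-fromLookup λ y e →
  trans (lookup-image π T y) (⊆-lookup S⊆T _ (trans (sym (lookup-image π S y)) e))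

∉-image : ∀ {n} (π : Permutation′ n) {S a} → a ∉ S → π ⟨$⟩ʳ a ∉ image π S
∉-image π {S} {a} a∉S πa∈ = a∉S (lookup⇒[]= a S (begin
  lookup S a                     ≡⟨ cong (lookup S) (sym (inverseˡ π)) ⟩
  lookup S (π ⟨$⟩ˡ (π ⟨$⟩ʳ a))  ≡⟨ sym (lookup-image π S _) ⟩
  lookup (image π S) (π ⟨$⟩ʳ a) ≡⟨ []=⇒lookup πa∈ ⟩
  true                           ∎))

image-flip : ∀ {n} (π : Permutation′ n) T → image π (image (flip π) T) ≡ T
image-flip π T = lookup-extensionality λ y → begin
  lookup (image π (image (flip π) T)) y ≡⟨ lookup-image π (image (flip π) T) y ⟩
  lookup (image (flip π) T) (π ⟨$⟩ˡ y)  ≡⟨ lookup-image (flip π) T _ ⟩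
  lookup T (π ⟨$⟩ʳ (π ⟨$⟩ˡ y))          ≡⟨ cong (lookup T) (inverseʳ π) ⟩
  lookup T y                            ∎

⊆-image⇒flip-⊆ : ∀ {n} (π : Permutation′ n) {T V} → T ⊆ image π V → image (flip π) T ⊆ V
⊆-image⇒flip-⊆ π {T} {V} T⊆ = subst (image (flip π) T ⊆_) V≡ (image-⊆ (flip π) T⊆)
  where
  V≡ : image (flip π) (image π V) ≡ V
  V≡ = image-flip (flip π) V

-- Quotients of disjoint unions of simplices

Pointwise-∈ˡ : ∀ {A B : Set} {R : A → B → Set} {xs ys x} →
               Pointwise R xs ys → x ∈ₗ xs → ∃ λ y → y ∈ₗ ys × R x y
Pointwise-∈ˡ (r ∷ _)  (here refl) = _ , here refl , r
Pointwise-∈ˡ (_ ∷ rs) (there x∈)  with Pointwise-∈ˡ rs x∈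
... | y , y∈ , r = y , there y∈ , r

Pointwise-∈ʳ : ∀ {A B : Set} {R : A → B → Set} {xs ys y} →
               Pointwise R xs ys → y ∈ₗ ys → ∃ λ x → x ∈ₗ xs × R x y
Pointwise-∈ʳ (r ∷ _)  (here refl) = _ , here refl , r
Pointwise-∈ʳ (_ ∷ rs) (there y∈)  with Pointwise-∈ʳ rs y∈
... | x , x∈ , r = x , there x∈ , r

glued-facets-distinct : ∀ {N k} (G : List (Gluing N k)) {g} →
                        Unique (usedFacets G) → g ∈ₗ G → (s₁ g , a₁ g) ≢ (s₂ g , a₂ g)
glued-facets-distinct (g ∷ G) ((facets-≢ ∷ _) ∷ _) (here refl) = facets-≢
glued-facets-distinct (g ∷ G) (_ ∷ _ ∷ unique)     (there g∈)  = glued-facets-distinct G unique g∈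

module Quotient {N k : ℕ} (G : List (Gluing N k)) where

  GlueStep-≢⊤ : ∀ {x y} → GlueStep G x y → proj₂ x ≢ ⊤ × proj₂ y ≢ ⊤
  GlueStep-≢⊤ (glue {g} _ V a∉V) =
      (λ V≡⊤ → a∉V (subst (a₁ g ∈_) (sym V≡⊤) ∈⊤))
    , (λ πV≡⊤ → ∉-image (π g) a∉V (subst (π g ⟨$⟩ʳ a₁ g ∈_) (sym πV≡⊤) ∈⊤))

  ~-facet : ∀ {s y} → (s , ⊤) ~[ G ] y → y ≡ (s , ⊤)
  ~-facet ε              = refl
  ~-facet (fwd step ◅ _) = contradiction refl (proj₁ (GlueStep-≢⊤ step))
  ~-facet (bwd step ◅ _) = contradiction refl (proj₂ (GlueStep-≢⊤ step))

  ~-∣∣ : ∀ {x y} → x ~[ G ] y → ∣ proj₂ x ∣ ≡ ∣ proj₂ y ∣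
  ~-∣∣ = EqClosure.gfold isEquivalence (∣_∣ ∘ proj₂)
           λ { (glue {g} _ V _) → sym (∣image∣ (π g) V) }

  ~-⊆ : ∀ {x y} → x ~[ G ] y → ∀ {T′} → T′ ⊆ proj₂ y →
        ∃ λ T → T ⊆ proj₂ x × (proj₁ x , T) ~[ G ] (proj₁ y , T′)
  ~-⊆ ε {T′} T′⊆ = T′ , T′⊆ , ε
  ~-⊆ (fwd (glue {g} g∈ V a∉V) ◅ x~y) T′⊆ with ~-⊆ x~y T′⊆
  ... | T , T⊆ , T~T′ = image (flip (π g)) T , T⁻⊆V ,
        fwd (subst (λ W → GlueStep G (s₁ g , image (flip (π g)) T) (s₂ g , W)) (image-flip (π g) T)
                   (glue g∈ _ (λ a∈ → a∉V (T⁻⊆V a∈)))) ◅ T~T′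
    where
    T⁻⊆V : image (flip (π g)) T ⊆ V
    T⁻⊆V = ⊆-image⇒flip-⊆ (π g) T⊆
  ~-⊆ (bwd (glue {g} g∈ V a∉V) ◅ x~y) T′⊆ with ~-⊆ x~y T′⊆
  ... | T , T⊆ , T~T′ = image (π g) T , image-⊆ (π g) T⊆ , bwd (glue g∈ T (a∉V ∘ T⊆)) ◅ T~T′

  ≼-⊆ : ∀ {x s S} → x ≼[ G ] (s , S) → ∃ λ T → T ⊆ S × x ~[ G ] (s , T)
  ≼-⊆ (x′ , _ , x~x′ , y~y′ , refl , x′⊆y′) with ~-⊆ y~y′ x′⊆y′
  ... | T , T⊆ , T~x′ = T , T⊆ , x~x′ ◅◅ EqClosure.symmetric _ T~x′

  ⊆⇒≼ : ∀ {s S T} → S ⊆ T → (s , S) ≼[ G ] (s , T)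
  ⊆⇒≼ {s} {S} {T} S⊆T = (s , S) , (s , T) , ε , ε , refl , S⊆T

-- Transport along a choice of apex vertex in every simplex

module ApexTransport {N n : ℕ} (apex : Fin N → Fin (suc (suc n))) where

  extend : Bool → Cell N n → Cell N (suc n)
  extend b (s , S) = s , insertAt S (apex s) b

  base : Cell N (suc n) → Cell N n
  base (s , V) = s , removeAt V (apex s)

  hasApex : Cell N (suc n) → Bool
  hasApex (s , V) = lookup V (apex s)

  base-extend : ∀ b x → base (extend b x) ≡ x
  base-extend b (s , S) = cong (s ,_) (removeAt-insertAt S (apex s) b)

  hasApex-extend : ∀ b x → hasApex (extend b x) ≡ b
  hasApex-extend b (s , S) = insertAt-lookup S (apex s) b

  extend-base : ∀ x → extend (hasApex x) (base x) ≡ x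
  extend-base (s , V) = cong (s ,_) (insertAt-removeAt V (apex s))

  -- g is the cone over g′: it glues the same facets, extended by the apexes,
  -- and its vertex bijection sends apex to apex.
  record IsConeOf (g : Gluing N (suc n)) (g′ : Gluing N n) : Set where
    field
      s₁-≡         : s₁ g ≡ s₁ g′
      s₂-≡         : s₂ g ≡ s₂ g′
      a₁-≡         : a₁ g ≡ punchIn (apex (s₁ g′)) (a₁ g′)
      a₂-≡         : a₂ g ≡ punchIn (apex (s₂ g′)) (a₂ g′)
      image-extend : ∀ b S → image (π g) (insertAt S (apex (s₁ g′)) b)
                             ≡ insertAt (image (π g′) S) (apex (s₂ g′)) b
  open IsConeOf

  module _ {G : List (Gluing N (suc n))} {G′ : List (Gluing N n)}
           (G≈ : Pointwise IsConeOf G G′) where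

    GlueStep-extend : ∀ b {x y} → GlueStep G′ x y → GlueStep G (extend b x) (extend b y)
    GlueStep-extend b (glue {g′} g′∈ S a∉S) with Pointwise-∈ʳ G≈ g′∈
    ... | g , g∈ , c =
      subst₂ (GlueStep G) (cong (_, _) (s₁-≡ c)) (cong₂ _,_ (s₂-≡ c) (image-extend c b S))
        (glue g∈ (insertAt S (apex (s₁ g′)) b) (subst (_∉ _) (sym (a₁-≡ c)) (∉-insertAt a∉S)))

    GlueStep-base : ∀ {g g′} → IsConeOf g g′ → g′ ∈ₗ G′ → ∀ V → a₁ g ∉ V →
      lookup V (apex (s₁ g′)) ≡ lookup (image (π g) V) (apex (s₂ g′))
      × GlueStep G′ (s₁ g′ , removeAt V (apex (s₁ g′)))
                    (s₂ g′ , removeAt (image (π g) V) (apex (s₂ g′)))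
    GlueStep-base {g} {g′} c g′∈ V a∉V =
        sym (trans (cong (λ W → lookup W (apex (s₂ g′))) πV≡) (insertAt-lookup S′ (apex (s₂ g′)) b))
      , subst (λ W → GlueStep G′ (s₁ g′ , S) (s₂ g′ , W))
              (sym (trans (cong (λ W → removeAt W (apex (s₂ g′))) πV≡) (removeAt-insertAt S′ (apex (s₂ g′)) b)))
              (glue g′∈ S (∉-removeAt (subst (_∉ V) (a₁-≡ c) a∉V)))
      where
      b = lookup V (apex (s₁ g′))
      S = removeAt V (apex (s₁ g′))
      S′ = image (π g′) S
      πV≡ : image (π g) V ≡ insertAt S′ (apex (s₂ g′)) b
      πV≡ = trans (cong (image (π g)) (sym (insertAt-removeAt V (apex (s₁ g′))))) (image-extend c b S)

    GlueStep⇒base : ∀ {x y} → GlueStep G x y → hasApex x ≡ hasApex y × GlueStep G′ (base x) (base y)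
    GlueStep⇒base (glue g∈ V a∉V) with Pointwise-∈ˡ G≈ g∈
    ... | g′ , g′∈ , c rewrite s₁-≡ c | s₂-≡ c = GlueStep-base c g′∈ V a∉V

    ~-extend : ∀ b {x y} → x ~[ G′ ] y → extend b x ~[ G ] extend b y
    ~-extend b = EqClosure.gmap (extend b) (GlueStep-extend b)

    ~-hasApex : ∀ {x y} → x ~[ G ] y → hasApex x ≡ hasApex y
    ~-hasApex = EqClosure.gfold isEquivalence hasApex (proj₁ ∘ GlueStep⇒base)

    ~-base : ∀ {x y} → x ~[ G ] y → base x ~[ G′ ] base y
    ~-base = EqClosure.gmap base (proj₂ ∘ GlueStep⇒base)

    base-~⇒~ : ∀ {x y} → hasApex x ≡ hasApex y → base x ~[ G′ ] base y → x ~[ G ] y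
    base-~⇒~ {x} {y} apex≡ base~ =
      subst₂ (_~[ G ]_) (extend-base x) (trans (cong (λ b → extend b (base y)) apex≡) (extend-base y))
        (~-extend (hasApex x) base~)

    ≼-base : ∀ {x y} → x ≼[ G ] y → (hasApex x ≤𝔹 hasApex y) × (base x ≼[ G′ ] base y)
    ≼-base ((s , V) , (_ , W) , x~ , y~ , refl , V⊆W) with removeAt-⊆ (apex s) V⊆W
    ... | apex≤ , base⊆ =
        subst₂ _≤𝔹_ (sym (~-hasApex x~)) (sym (~-hasApex y~)) apex≤
      , base (s , V) , base (s , W) , ~-base x~ , ~-base y~ , refl , base⊆

    base-≼⇒≼ : ∀ {x y} → hasApex x ≤𝔹 hasApex y → base x ≼[ G′ ] base y → x ≼[ G ] y
    base-≼⇒≼ {x} {y} apex≤ ((s , S) , (_ , T) , x~ , y~ , refl , S⊆T) =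
        extend (hasApex x) (s , S) , extend (hasApex y) (s , T)
      , subst (_~[ G ] extend (hasApex x) (s , S)) (extend-base x) (~-extend (hasApex x) x~)
      , subst (_~[ G ] extend (hasApex y) (s , T)) (extend-base y) (~-extend (hasApex y) y~)
      , refl , insertAt-⊆⁺ apex≤ S⊆T

    -- The shared face of the glued facets gains or loses the apex.
    Admissible-extend : ∀ t {g g′} → IsConeOf g g′ → Admissible t G′ g′ → Admissible t G g
    Admissible-extend t {g} {g′} c (S , T , a∉S , a∉T , n∸t≤∣S∣ , S~T) =
        insertAt S (apex (s₁ g′)) true , insertAt T (apex (s₂ g′)) true
      , subst (_∉ _) (sym (a₁-≡ c)) (∉-insertAt {S = S} a∉S)
      , subst (_∉ _) (sym (a₂-≡ c)) (∉-insertAt {S = T} a∉T)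
      , subst (suc n ∸ t ≤_) (sym (∣insertAt∣ S (apex (s₁ g′)) true)) (m∸n≤k⇒1+m∸n≤1+k n t _ n∸t≤∣S∣)
      , subst₂ (_~[ G ]_) (cong (_, _) (sym (s₁-≡ c))) (cong (_, _) (sym (s₂-≡ c))) (~-extend true S~T)

    Admissible-base : ∀ t {g g′} → IsConeOf g g′ → Admissible t G g → Admissible t G′ g′
    Admissible-base t {g} {g′} c (V , W , a∉V , a∉W , 1+n∸t≤∣V∣ , V~W) =
        removeAt V (apex (s₁ g′)) , removeAt W (apex (s₂ g′))
      , ∉-removeAt (subst (_∉ V) (a₁-≡ c) a∉V)
      , ∉-removeAt (subst (_∉ W) (a₂-≡ c) a∉W)
      , 1+m∸n≤1+k⇒m∸n≤k n t _ (≤-trans 1+n∸t≤∣V∣ (∣V∣≤1+∣removeAt∣ V (apex (s₁ g′))))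
      , subst₂ (λ s s′ → (s , removeAt V (apex s)) ~[ G′ ] (s′ , removeAt W (apex s′)))
               (s₁-≡ c) (s₂-≡ c) (~-base V~W)

  LCSteps-extend : ∀ t {G G′ E E′} → Pointwise IsConeOf G G′ → Pointwise IsConeOf E E′ →
                   LCSteps t G′ E′ → LCSteps t G E
  LCSteps-extend t G≈ []       _              = tt
  LCSteps-extend t G≈ (c ∷ E≈) (adm , steps) =
    Admissible-extend G≈ t c adm , LCSteps-extend t (Pointwise.++⁺ G≈ (c ∷ [])) E≈ steps

  LCSteps-base : ∀ t {G G′ E E′} → Pointwise IsConeOf G G′ → Pointwise IsConeOf E E′ →
                 LCSteps t G E → LCSteps t G′ E′
  LCSteps-base t G≈ []       _              = tt
  LCSteps-base t G≈ (c ∷ E≈) (adm , steps) =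
    Admissible-base G≈ t c adm , LCSteps-base t (Pointwise.++⁺ G≈ (c ∷ [])) E≈ steps

  extendFacet : Fin N × Fin (suc n) → Fin N × Fin (suc (suc n))
  extendFacet (s , a) = s , punchIn (apex s) a

  extendFacet-injective : ∀ {x y} → extendFacet x ≡ extendFacet y → x ≡ y
  extendFacet-injective {s , a} {_ , b} refl⇒ with cong proj₁ refl⇒
  ... | refl = cong (s ,_) (punchIn-injective (apex s) a b (cong proj₂ refl⇒))

  usedFacets-extend : ∀ {G G′} → Pointwise IsConeOf G G′ →
                      usedFacets G ≡ List.map extendFacet (usedFacets G′)
  usedFacets-extend []       = refl
  usedFacets-extend (c ∷ G≈) =
    cong₂ _∷_ (cong₂ _,_ (s₁-≡ c) (a₁-≡ c))
      (cong₂ _∷_ (cong₂ _,_ (s₂-≡ c) (a₂-≡ c)) (usedFacets-extend G≈))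

  IsoToQuotient-cone : ∀ {G G′} (P : RawPoset) → Pointwise IsConeOf G G′ →
                       IsoToQuotient P G′ → IsoToQuotient (cone P) G
  IsoToQuotient-cone {G} P G≈ (f , f-onto , f-≡ , f-≼) = F , F-onto , F-≡ , F-≼
    where
    open RawPoset P
    F : Cell N (suc n) → Carrier × Bool
    F x = f (base x) , hasApex x
    F-onto : ∀ c → ∃ λ x → F x ≡ c
    F-onto (c , b) with f-onto c
    ... | x , fx≡c = extend b x , cong₂ _,_ (trans (cong f (base-extend b x)) fx≡c) (hasApex-extend b x)
    F-≡ : ∀ x y → (F x ≡ F y) ⇔ (x ~[ G ] y)
    F-≡ x y = mk⇔
      (λ Fx≡Fy → base-~⇒~ G≈ (cong proj₂ Fx≡Fy) (to (f-≡ (base x) (base y)) (cong proj₁ Fx≡Fy)))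
      (λ x~y → cong₂ _,_ (from (f-≡ (base x) (base y)) (~-base G≈ x~y)) (~-hasApex G≈ x~y))
    F-≼ : ∀ x y → RawPoset._≼_ (cone P) (F x) (F y) ⇔ (x ≼[ G ] y)
    F-≼ x y = mk⇔
      (λ (fx≼fy , apex≤) → base-≼⇒≼ G≈ apex≤ (to (f-≼ (base x) (base y)) fx≼fy))
      (λ x≼y → from (f-≼ (base x) (base y)) (proj₂ (≼-base G≈ x≼y)) , proj₁ (≼-base G≈ x≼y))

  IsoToQuotient-uncone : ∀ {G G′} (P : RawPoset) → Pointwise IsConeOf G G′ →
                         (iso : IsoToQuotient (cone P) G) →
                         (∀ x → proj₂ (proj₁ iso x) ≡ hasApex x) → IsoToQuotient P G′
  IsoToQuotient-uncone {G} {G′} P G≈ (F , F-onto , F-≡ , F-≼) F-apex = f , f-onto , f-≡ , f-≼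
    where
    open RawPoset P
    f : Cell N n → Carrier
    f x = proj₁ (F (extend false x))
    F-extend-apex : ∀ x → proj₂ (F (extend false x)) ≡ false
    F-extend-apex x = trans (F-apex (extend false x)) (hasApex-extend false x)
    F-extend : ∀ x → F (extend false x) ≡ (f x , false)
    F-extend x = cong (f x ,_) (F-extend-apex x)
    f-onto : ∀ c → ∃ λ x → f x ≡ c
    f-onto c with F-onto (c , false)
    ... | y , Fy≡c = base y , (begin
      proj₁ (F (extend false (base y)))       ≡⟨ cong (λ b → proj₁ (F (extend b (base y)))) (sym apex≡) ⟩
      proj₁ (F (extend (hasApex y) (base y))) ≡⟨ cong (proj₁ ∘ F) (extend-base y) ⟩
      proj₁ (F y)                             ≡⟨ cong proj₁ Fy≡c ⟩
      c                                       ∎)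
      where
      apex≡ : hasApex y ≡ false
      apex≡ = trans (sym (F-apex y)) (cong proj₂ Fy≡c)
    f-≡ : ∀ x y → (f x ≡ f y) ⇔ (x ~[ G′ ] y)
    f-≡ x y = mk⇔
      (λ fx≡fy → subst₂ (_~[ G′ ]_) (base-extend false x) (base-extend false y)
                   (~-base G≈ (to (F-≡ _ _) (begin
                     F (extend false x) ≡⟨ F-extend x ⟩
                     (f x , false)      ≡⟨ cong (_, false) fx≡fy ⟩
                     (f y , false)      ≡⟨ sym (F-extend y) ⟩
                     F (extend false y) ∎))))
      (λ x~y → cong proj₁ (from (F-≡ _ _) (~-extend G≈ false x~y)))
    f-≼ : ∀ x y → (f x ≼ f y) ⇔ (x ≼[ G′ ] y)
    f-≼ x y = mk⇔
      (λ fx≼fy → subst₂ (_≼[ G′ ]_) (base-extend false x) (base-extend false y)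
                   (proj₂ (≼-base G≈ (to (F-≼ _ _) (fx≼fy , false≤𝔹 (F-extend-apex x))))))
      (λ x≼y → proj₁ (from (F-≼ _ _)
         (base-≼⇒≼ G≈ (false≤𝔹 (hasApex-extend false x))
                      (subst₂ (_≼[ G′ ]_) (sym (base-extend false x)) (sym (base-extend false y)) x≼y))))

coneGluing : ∀ {N n} → Gluing N n → Gluing N (suc n)
coneGluing g = record
  { s₁ = s₁ g ; s₂ = s₂ g ; a₁ = fsuc (a₁ g) ; a₂ = fsuc (a₂ g)
  ; π = lift₀ (π g) ; π-a = cong fsuc (π-a g) }

coneGluing-isConeOf : ∀ {N n} (g : Gluing N n) →
                      ApexTransport.IsConeOf (λ _ → fzero) (coneGluing g) g
coneGluing-isConeOf g = record
  { s₁-≡ = refl ; s₂-≡ = refl ; a₁-≡ = refl ; a₂-≡ = refl ; image-extend = λ _ _ → refl }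

IsLC-cone : ∀ t d (C : SimplicialRegularCW) → IsLC t d (raw C) → IsLC t (suc d) (cone (raw C))
IsLC-cone t d C (m , tg , es , tree , unique , steps , iso) =
  m , coneGluing ∘ tg , List.map coneGluing es , tree , unique′ , steps′ ,
  IsoToQuotient-cone (raw C) G≈ iso
  where
  open ApexTransport {suc m} {d} (λ _ → fzero)
  tree≈ : Pointwise IsConeOf (List.tabulate (coneGluing ∘ tg)) (List.tabulate tg)
  tree≈ = Pointwise.tabulate⁺ (coneGluing-isConeOf ∘ tg)
  es≈ : Pointwise IsConeOf (List.map coneGluing es) es
  es≈ = subst (Pointwise IsConeOf _) (map-id es)
              (Pointwise.map⁺ coneGluing id (Pointwise.refl (coneGluing-isConeOf _)))
  G≈ = Pointwise.++⁺ tree≈ es≈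
  unique′ = subst Unique (sym (usedFacets-extend G≈)) (Uniqueₚ.map⁺ extendFacet-injective unique)
  steps′ = LCSteps-extend t tree≈ es≈ steps

-- The apexes in a presentation of a cone

module ApexOfCone (C : SimplicialRegularCW) {N d : ℕ} (G : List (Gluing N (suc d)))
                  (iso : IsoToQuotient (cone (raw C)) G) (unique : Unique (usedFacets G)) where
  open SimplicialRegularCW C
  open IsPartialOrder isPartialOrder using (antisym) renaming (refl to ≤ₚ-refl)
  open Quotient G

  _⊑_ : Fin size × Bool → Fin size × Bool → Set
  _⊑_ = RawPoset._≼_ (cone (raw C))

  F : Cell N (suc d) → Fin size × Bool
  F = proj₁ iso

  F-onto : ∀ c → ∃ λ x → F x ≡ c
  F-onto = proj₁ (proj₂ iso)

  ~⇒F≡ : ∀ {x y} → x ~[ G ] y → F x ≡ F y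
  ~⇒F≡ {x} {y} = from (proj₁ (proj₂ (proj₂ iso)) x y)

  F≡⇒~ : ∀ {x y} → F x ≡ F y → x ~[ G ] y
  F≡⇒~ {x} {y} = to (proj₁ (proj₂ (proj₂ iso)) x y)

  ≼⇒F⊑ : ∀ {x y} → x ≼[ G ] y → F x ⊑ F y
  ≼⇒F⊑ {x} {y} = from (proj₂ (proj₂ (proj₂ iso)) x y)

  F⊑⇒≼ : ∀ {x y} → F x ⊑ F y → x ≼[ G ] y
  F⊑⇒≼ {x} {y} = to (proj₂ (proj₂ (proj₂ iso)) x y)

  F-below : ∀ {s S} c → c ⊑ F (s , S) → ∃ λ T → T ⊆ S × F (s , T) ≡ c
  F-below {s} {S} c c⊑ with F-onto c
  ... | y , Fy≡c with ≼-⊆ (F⊑⇒≼ {y} {s , S} (subst (_⊑ F (s , S)) (sym Fy≡c) c⊑))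
  ... | T , T⊆S , y~ = T , T⊆S , trans (sym (~⇒F≡ y~)) Fy≡c

  F-⊥ : ∀ s → F (s , ⊥) ≡ (empty , false)
  F-⊥ s with F-below {s} {⊥} (empty , false) (empty-least _ , tt)
  ... | T , T⊆⊥ , FT≡ = subst (λ T → F (s , T) ≡ (empty , false)) (⊆⊥⇒≡⊥ T⊆⊥) FT≡

  facet-maximal : ∀ {s y} → (s , ⊤) ≼[ G ] y → F y ≡ F (s , ⊤)
  facet-maximal (x′ , (_ , W) , x~x′ , y~y′ , refl , x′⊆W) with ~-facet x~x′
  ... | refl = trans (~⇒F≡ y~y′) (cong (λ W → F (_ , W)) (⊆-antisym ⊆⊤ x′⊆W))

  -- F (s , ⊤) lies below a cell with the apex, so by maximality it is one.
  facet-hasApex : ∀ s → proj₂ (F (s , ⊤)) ≡ true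
  facet-hasApex s with F-onto (proj₁ (F (s , ⊤)) , true)
  ... | y , Fy≡ = begin
    proj₂ (F (s , ⊤)) ≡⟨ cong proj₂ (sym (facet-maximal (F⊑⇒≼ (subst (F (s , ⊤) ⊑_) (sym Fy≡) F⊤⊑)))) ⟩
    proj₂ (F y)       ≡⟨ cong proj₂ Fy≡ ⟩
    true              ∎
    where
    F⊤⊑ : F (s , ⊤) ⊑ (proj₁ (F (s , ⊤)) , true)
    F⊤⊑ = ≤ₚ-refl , true⇒≤𝔹 (λ _ → refl)

  -- Abstract, since normalising the chosen vertex makes type checking very slow.
  abstract
   apexVertex : ∀ s → ∃ λ i → F (s , ⁅ i ⁆) ≡ (empty , true)
   apexVertex s with F-below {s} {⊤} (empty , true) (empty-least _ , true⇒≤𝔹 (λ _ → facet-hasApex s))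
   ... | T , _ , FT≡v with nonempty? T
   ... | no T-empty =
     contradiction (trans (sym (F-⊥ s)) (subst (λ T → F (s , T) ≡ _) (Empty-unique T-empty) FT≡v)) λ ()
   ... | yes (i , i∈T) = i , cong₂ _,_ base≡ apex≡
     where
     ⁅i⁆⊑v : F (s , ⁅ i ⁆) ⊑ (empty , true)
     ⁅i⁆⊑v = subst (F (s , ⁅ i ⁆) ⊑_) FT≡v (≼⇒F⊑ (⊆⇒≼ (∈⇒⁅⁆⊆ i∈T)))
     base≡ : proj₁ (F (s , ⁅ i ⁆)) ≡ empty
     base≡ = antisym (proj₁ ⁅i⁆⊑v) (empty-least _)
     apex≡ : proj₂ (F (s , ⁅ i ⁆)) ≡ true
     apex≡ with proj₂ (F (s , ⁅ i ⁆)) in F⁅i⁆₂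
     ... | true  = refl
     ... | false = contradiction (~-∣∣ (F≡⇒~ (trans (cong₂ _,_ base≡ F⁅i⁆₂) (sym (F-⊥ s))))) ∣⁅i⁆∣≢∣⊥∣
       where
       ∣⁅i⁆∣≢∣⊥∣ : ∣ ⁅ i ⁆ ∣ ≢ ∣ ⊥ {suc (suc d)} ∣
       ∣⁅i⁆∣≢∣⊥∣ eq with () ← trans (sym (∣⁅x⁆∣≡1 i)) (trans eq (∣⊥∣≡0 (suc (suc d))))

  apex : Fin N → Fin (suc (suc d))
  apex s = proj₁ (apexVertex s)

  open ApexTransport apex using (extend; hasApex; hasApex-extend; extend-base; base)

  apex∈⇒hasApex : ∀ s {V} → lookup V (apex s) ≡ true → proj₂ (F (s , V)) ≡ true
  apex∈⇒hasApex s {V} V[apex] =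
    ≤𝔹-true (proj₂ (subst (_⊑ F (s , V)) (proj₂ (apexVertex s)) (≼⇒F⊑ (⊆⇒≼ ⁅apex⁆⊆V)))) refl
    where
    ⁅apex⁆⊆V : ⁅ apex s ⁆ ⊆ V
    ⁅apex⁆⊆V = ∈⇒⁅⁆⊆ (lookup⇒[]= _ V V[apex])

  -- The cell of the cone F (extend true x) is v ∗ σ, with σ = F (extend false x).
  base-independent : ∀ x → proj₁ (F (extend true x)) ≡ proj₁ (F (extend false x))
  base-independent (s , S)
    with F-below {s} {insertAt S (apex s) true} (proj₁ (F (extend true (s , S))) , false) (≤ₚ-refl , tt)
  ... | T , T⊆ , FT≡ = antisym σ₁≤σ₀ σ₀≤σ₁
    where
    T[apex] : lookup T (apex s) ≡ false
    T[apex] with lookup T (apex s) in T[apex]≡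
    ... | false = refl
    ... | true  = contradiction (trans (sym (apex∈⇒hasApex s T[apex]≡)) (cong proj₂ FT≡)) λ ()
    σ₁≤σ₀ : proj₁ (F (extend true (s , S))) ≤ₚ proj₁ (F (extend false (s , S)))
    σ₁≤σ₀ = subst (λ c → proj₁ c ≤ₚ proj₁ (F (extend false (s , S)))) FT≡
                  (proj₁ (≼⇒F⊑ (⊆⇒≼ (⊆-insertAt-false T⊆ T[apex]))))
    σ₀≤σ₁ : proj₁ (F (extend false (s , S))) ≤ₚ proj₁ (F (extend true (s , S)))
    σ₀≤σ₁ = proj₁ (≼⇒F⊑ (⊆⇒≼ (insertAt-⊆⁺ tt id)))

  -- Otherwise F (extend false x) = F (extend true x), but the cells differ in size.
  F-extend-false : ∀ x → proj₂ (F (extend false x)) ≡ false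
  F-extend-false (s , S) with proj₂ (F (extend false (s , S))) in F₂≡
  ... | false = refl
  ... | true  = contradiction (~-∣∣ (F≡⇒~ F₀≡F₁)) ∣V₀∣≢∣V₁∣
    where
    F₀≡F₁ : F (extend false (s , S)) ≡ F (extend true (s , S))
    F₀≡F₁ = cong₂ _,_ (sym (base-independent (s , S)))
                      (trans F₂≡ (sym (apex∈⇒hasApex s (hasApex-extend true (s , S)))))
    ∣V₀∣≢∣V₁∣ : ∣ insertAt S (apex s) false ∣ ≢ ∣ insertAt S (apex s) true ∣
    ∣V₀∣≢∣V₁∣ eq =
      1+n≢n (sym (trans (sym (∣insertAt∣ S (apex s) false)) (trans eq (∣insertAt∣ S (apex s) true))))

  F-hasApex : ∀ x → proj₂ (F x) ≡ hasApex x
  F-hasApex x = subst (λ y → proj₂ (F y) ≡ hasApex y) (extend-base x) (on-extend (hasApex x) (base x))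
    where
    on-extend : ∀ b y → proj₂ (F (extend b y)) ≡ hasApex (extend b y)
    on-extend true  y@(s , _) = trans (apex∈⇒hasApex s (hasApex-extend true y)) (sym (hasApex-extend true y))
    on-extend false y       = trans (F-extend-false y) (sym (hasApex-extend false y))

  F-facet : ∀ s → F (s , ⊤) ≡ (proj₁ (F (extend false (s , ⊤))) , true)
  F-facet s = cong₂ _,_ (trans (cong (λ V → proj₁ (F (s , V))) (sym (insertAt-⊤ (apex s))))
                               (base-independent (s , ⊤)))
                        (facet-hasApex s)

  -- Were the apex removed, the glued facets would be the bases σ₁, σ₂ of the
  -- facets v ∗ σ₁, v ∗ σ₂ of the cone; then those coincide, hence so do s₁ g, s₂ g.
  gluing-avoids-apex : ∀ {g} → g ∈ₗ G → a₁ g ≢ apex (s₁ g)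
  gluing-avoids-apex {g} g∈ a₁≡apex =
    glued-facets-distinct G unique g∈ (cong₂ _,_ s₁≡s₂ (trans a₁≡apex (trans (cong apex s₁≡s₂) apex₂≡a₂)))
    where
    σ₁ = insertAt ⊤ (apex (s₁ g)) false
    glued : (s₁ g , σ₁) ~[ G ] (s₂ g , image (π g) σ₁)
    glued = fwd (glue g∈ σ₁ a₁∉σ₁) ◅ ε
      where
      a₁∉σ₁ : a₁ g ∉ σ₁
      a₁∉σ₁ a∈ = contradiction (trans (sym ([]=⇒lookup a∈))
                                      (trans (cong (lookup σ₁) a₁≡apex) (insertAt-lookup ⊤ (apex (s₁ g)) false))) λ ()
    πσ₁≡ : image (π g) σ₁ ≡ insertAt ⊤ (a₂ g) false
    πσ₁≡ = trans (image-insertAt (π g) ⊤ (apex (s₁ g)) false)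
                 (cong₂ (λ W i → insertAt W i false) (image-⊤ (remove (apex (s₁ g)) (π g)))
                        (trans (cong (π g ⟨$⟩ʳ_) (sym a₁≡apex)) (π-a g)))
    apex₂≡a₂ : apex (s₂ g) ≡ a₂ g
    apex₂≡a₂ = insertAt-⊤-false (begin
      lookup (insertAt ⊤ (a₂ g) false) (apex (s₂ g)) ≡⟨ cong (λ W → lookup W (apex (s₂ g))) (sym πσ₁≡) ⟩
      lookup (image (π g) σ₁) (apex (s₂ g))          ≡⟨ sym (F-hasApex (s₂ g , image (π g) σ₁)) ⟩
      proj₂ (F (s₂ g , image (π g) σ₁))              ≡⟨ cong proj₂ (sym (~⇒F≡ glued)) ⟩
      proj₂ (F (s₁ g , σ₁))                           ≡⟨ F-extend-false (s₁ g , ⊤) ⟩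
      false                                           ∎)
    glued⊤ : extend false (s₁ g , ⊤) ~[ G ] extend false (s₂ g , ⊤)
    glued⊤ = subst (λ W → (s₁ g , σ₁) ~[ G ] (s₂ g , W))
                   (trans πσ₁≡ (cong (λ i → insertAt ⊤ i false) (sym apex₂≡a₂))) glued
    s₁≡s₂ : s₁ g ≡ s₂ g
    s₁≡s₂ = sym (cong proj₁ (~-facet (F≡⇒~ (begin
      F (s₁ g , ⊤)                                  ≡⟨ F-facet (s₁ g) ⟩
      (proj₁ (F (extend false (s₁ g , ⊤))) , true) ≡⟨ cong (λ c → proj₁ c , true) (~⇒F≡ glued⊤) ⟩
      (proj₁ (F (extend false (s₂ g , ⊤))) , true) ≡⟨ sym (F-facet (s₂ g)) ⟩
      F (s₂ g , ⊤)                                  ∎))))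

  gluing-preserves-apex : ∀ {g} → g ∈ₗ G → π g ⟨$⟩ʳ apex (s₁ g) ≡ apex (s₂ g)
  gluing-preserves-apex {g} g∈ = trans (cong (π g ⟨$⟩ʳ_) (sym π⁻¹apex₂≡apex₁)) (inverseʳ (π g))
    where
    v₁ = ⁅ apex (s₁ g) ⁆
    glued : (s₁ g , v₁) ~[ G ] (s₂ g , image (π g) v₁)
    glued = fwd (glue g∈ v₁ (λ a∈ → gluing-avoids-apex g∈ (x∈⁅y⁆⇒x≡y _ a∈))) ◅ ε
    apex₂∈ : lookup (image (π g) v₁) (apex (s₂ g)) ≡ true
    apex₂∈ = begin
      lookup (image (π g) v₁) (apex (s₂ g)) ≡⟨ sym (F-hasApex (s₂ g , image (π g) v₁)) ⟩
      proj₂ (F (s₂ g , image (π g) v₁))     ≡⟨ cong proj₂ (sym (~⇒F≡ glued)) ⟩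
      proj₂ (F (s₁ g , v₁))                  ≡⟨ cong proj₂ (proj₂ (apexVertex (s₁ g))) ⟩
      true                                   ∎
    π⁻¹apex₂≡apex₁ : π g ⟨$⟩ˡ apex (s₂ g) ≡ apex (s₁ g)
    π⁻¹apex₂≡apex₁ = x∈⁅y⁆⇒x≡y _ (lookup⇒[]= _ v₁ (trans (sym (lookup-image (π g) v₁ _)) apex₂∈))

-- punchOut i j, with the junk value 0 when j ≡ i.
punchOut₀ : ∀ {k} → Fin (suc (suc k)) → Fin (suc (suc k)) → Fin (suc k)
punchOut₀ i j with j ≟ᶠ i
... | yes _   = fzero
... | no  j≢i = punchOut (j≢i ∘ sym)

punchIn-punchOut₀ : ∀ {k} {i j : Fin (suc (suc k))} → j ≢ i → punchIn i (punchOut₀ i j) ≡ j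
punchIn-punchOut₀ {i = i} {j} j≢i with j ≟ᶠ i
... | yes j≡i = contradiction j≡i j≢i
... | no  _   = punchIn-punchOut _

module RemoveApex {N d : ℕ} (apex : Fin N → Fin (suc (suc d))) where
  open ApexTransport apex using (IsConeOf)

  removeApex : Gluing N (suc d) → Gluing N d
  removeApex g = record
    { s₁ = s₁ g ; s₂ = s₂ g ; a₁ = a ; a₂ = π′ ⟨$⟩ʳ a ; π = π′ ; π-a = refl }
    where
    π′ = remove (apex (s₁ g)) (π g)
    a  = punchOut₀ (apex (s₁ g)) (a₁ g)

  ApexPreserving : Gluing N (suc d) → Set
  ApexPreserving g = a₁ g ≢ apex (s₁ g) × π g ⟨$⟩ʳ apex (s₁ g) ≡ apex (s₂ g)

  removeApex-isConeOf : ∀ {g} → ApexPreserving g → IsConeOf g (removeApex g)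
  removeApex-isConeOf {g} (a₁≢apex , π-apex) = record
    { s₁-≡ = refl ; s₂-≡ = refl
    ; a₁-≡ = sym (punchIn-punchOut₀ a₁≢apex)
    ; a₂-≡ = begin
      a₂ g                                        ≡⟨ sym (π-a g) ⟩
      π g ⟨$⟩ʳ a₁ g                               ≡⟨ cong (π g ⟨$⟩ʳ_) (sym (punchIn-punchOut₀ a₁≢apex)) ⟩
      π g ⟨$⟩ʳ punchIn (apex (s₁ g)) a            ≡⟨ punchIn-permute (π g) (apex (s₁ g)) a ⟩
      punchIn (π g ⟨$⟩ʳ apex (s₁ g)) (π′ ⟨$⟩ʳ a) ≡⟨ cong (λ i → punchIn i (π′ ⟨$⟩ʳ a)) π-apex ⟩
      punchIn (apex (s₂ g)) (π′ ⟨$⟩ʳ a)          ∎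
    ; image-extend = λ b S → trans (image-insertAt (π g) S (apex (s₁ g)) b)
                                   (cong (λ i → insertAt (image π′ S) i b) π-apex) }
    where
    π′ = remove (apex (s₁ g)) (π g)
    a  = punchOut₀ (apex (s₁ g)) (a₁ g)

  map-removeApex : ∀ {L} → All ApexPreserving L → Pointwise IsConeOf L (List.map removeApex L)
  map-removeApex []       = []
  map-removeApex (p ∷ ps) = removeApex-isConeOf p ∷ map-removeApex ps

IsLC-uncone : ∀ t d (C : SimplicialRegularCW) → IsLC t (suc d) (cone (raw C)) → IsLC t d (raw C)
IsLC-uncone t d C (m , tg , es , tree , unique , steps , iso) =
  m , removeApex ∘ tg , List.map removeApex es , tree , unique′ , steps′ ,
  IsoToQuotient-uncone (raw C) G≈ iso F-hasApex
  where
  G = List.tabulate tg ++ es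
  open ApexOfCone C G iso unique using (apex; F-hasApex; gluing-avoids-apex; gluing-preserves-apex)
  open ApexTransport apex
  open RemoveApex apex
  preserving : ∀ {g} → g ∈ₗ G → ApexPreserving g
  preserving g∈ = gluing-avoids-apex g∈ , gluing-preserves-apex g∈
  tree≈ : Pointwise IsConeOf (List.tabulate tg) (List.tabulate (removeApex ∘ tg))
  tree≈ = Pointwise.tabulate⁺ (λ k → removeApex-isConeOf (preserving (∈-++⁺ˡ (∈-tabulate⁺ k))))
  es≈ : Pointwise IsConeOf es (List.map removeApex es)
  es≈ = map-removeApex (All.tabulate (preserving ∘ ∈-++⁺ʳ (List.tabulate tg)))
  G≈ = Pointwise.++⁺ tree≈ es≈
  unique′ = Uniqueₚ.map⁻ (subst Unique (usedFacets-extend G≈) unique)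
  steps′ = LCSteps-base t tree≈ es≈ steps

proposition2p12 : (t d : ℕ) → 1 ≤ t → t ≤ d → (C : SimplicialRegularCW) → IsPseudomanifold C d
    → IsLC t d (raw C) ⇔ IsLC t (suc d) (cone (raw C))
proposition2p12 t d _ _ C _ = mk⇔ (IsLC-cone t d C) (IsLC-uncone t d C)
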